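{- Let $(\alpha_k,\beta_k)_{k\ge0}$ be a Bailey pair relative to $q$. Then for every integer $p\ge1$ and every integer $n\ge1$, $$\sum_{n-1\ge n_p\ge\cdots\ge n_1\ge0}\frac{q^{(n-n_p-1)(n-n_p)}\beta_{n-n_p-1}}{(q)_{n_p}}\prod_{i=1}^{p-1}q^{(n-n_i-1)(n-n_i)}\begin{bmatrix} n_{i+1}\\ n_i\end{bmatrix} = \frac{1}{(q)_{n-1}(q^2)_{n-1}}\sum_{k=0}^{n-1}\frac{(q^{1-n})_k}{(q^{1+n})_k}(-1)^kq^{nk-\binom{k+1}{2}+p(k^2+k)}\alpha_k.$$
   Context: $q$ is an indeterminate (identities are of rational functions / formal series in $q$). $(a)_n=(a;q)_n=\prod_{k=1}^n(1-aq^{k-1})$, and $\begin{bmatrix} n\\ k\end{bmatrix}=\frac{(q)_n}{(q)_{n-k}(q)_k}$. A pair of sequences $(\alpha_n,\beta_n)_{n\ge0}$ is a Bailey pair relative to $a$ if $\beta_n=\sum_{k=0}^n\frac{\alpha_k}{(q)_{n-k}(aq)_{n+k}}$ for all $n\ge0$. -}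

module Defs where

open import Level using (Level)
open import Data.Nat as ℕ using (ℕ; zero; suc; _∸_)
open import Data.Nat.Combinatorics using (_C_)
open import Data.Integer as ℤ using (ℤ; +_; -[1+_]) renaming (_+_ to _+ℤ_; _-_ to _-ℤ_)
open import Data.List using (List; []; _∷_; concatMap; map)
open import Algebra.Bundles using (CommutativeRing)

-- All q-series notions, over a commutative ring R in which
--   * q has a two-sided inverse  qi  (q * qi ≈ 1#), and
--   * u j is an inverse of (1 - q^(j+1)) for every j : ℕ.
-- (E.g. R = ℚ(q), the field of rational functions in the indeterminate q.)
module QSeries {c ℓ : Level} (R : CommutativeRing c ℓ)
  (q qi : CommutativeRing.Carrier R) (u : ℕ → CommutativeRing.Carrier R) where

  open CommutativeRing R

  _−_ : Carrier → Carrier → Carrier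
  x − y = x + (- y)

  pow : Carrier → ℕ → Carrier
  pow x zero = 1#
  pow x (suc n) = x * pow x n

  qz : ℤ → Carrier
  qz (+ n) = pow q n
  qz -[1+ n ] = pow qi (suc n)

  sumTo : ℕ → (ℕ → Carrier) → Carrier
  sumTo zero f = 0#
  sumTo (suc m) f = sumTo m f + f m

  prodTo : ℕ → (ℕ → Carrier) → Carrier
  prodTo zero f = 1#
  prodTo (suc m) f = prodTo m f * f m

  poch : ℤ → ℕ → Carrier
  poch e k = prodTo k (λ j → 1# − qz (e +ℤ (+ j)))

  qfac : ℕ → Carrier
  qfac m = poch (+ 1) m

  -- 1 / (q^(1+s); q)_m = prod_{j<m} 1/(1 - q^(s+j+1))
  invPoch : ℕ → ℕ → Carrier
  invPoch s m = prodTo m (λ j → u (s ℕ.+ j))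

  invQfac : ℕ → Carrier
  invQfac m = invPoch 0 m

  -- q-binomial [m choose k] = (q)_m / ((q)_{m-k} (q)_k)   (used with k ≤ m)
  qbinom : ℕ → ℕ → Carrier
  qbinom m k = qfac m * (invQfac (m ∸ k) * invQfac k)

  -- Bailey pair relative to a = q:
  --   β_n = Σ_{k=0}^n α_k / ((q)_{n-k} (aq)_{n+k}),  (aq)_{m} = (q^2;q)_m
  IsBaileyPairRelq : (ℕ → Carrier) → (ℕ → Carrier) → Set ℓ
  IsBaileyPairRelq α β = ∀ n →
    β n ≈ sumTo (suc n) (λ k → α k * (invQfac (n ∸ k) * invPoch 1 (n ℕ.+ k)))

  -- chains l p b : all lists [n_p, n_{p-1}, ..., n_1] of length p with
  --   b ≥ n_p ≥ n_{p-1} ≥ ... ≥ n_1 ≥ 0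
  upto : ℕ → List ℕ
  upto zero = 0 ∷ []
  upto (suc b) = 0 ∷ map suc (upto b)

  chains : ℕ → ℕ → List (List ℕ)
  chains zero b = [] ∷ []
  chains (suc p) b = concatMap (λ m → map (m ∷_) (chains p m)) (upto b)

  sumList : List Carrier → Carrier
  sumList [] = 0#
  sumList (x ∷ xs) = x + sumList xs

  module _ (n : ℕ) (β : ℕ → Carrier) where
    wexp : ℕ → Carrier
    wexp a = pow q ((n ∸ a ∸ 1) ℕ.* (n ∸ a))

    pairProd : List ℕ → Carrier
    pairProd [] = 1#
    pairProd (b ∷ []) = 1#
    pairProd (b ∷ a ∷ rest) = (wexp a * qbinom b a) * pairProd (a ∷ rest)

    chainTerm : List ℕ → Carrier
    chainTerm [] = 1#
    chainTerm (np ∷ rest) =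
      (wexp np * β (n ∸ np ∸ 1) * invQfac np) * pairProd (np ∷ rest)

    lhs : ℕ → Carrier
    lhs p = sumList (map chainTerm (chains p (n ∸ 1)))

  rhs : (ℕ → Carrier) → ℕ → ℕ → Carrier
  rhs α p n =
    (invQfac (n ∸ 1) * invPoch 1 (n ∸ 1)) *
    sumTo n (λ k →
      poch ((+ 1) -ℤ (+ n)) k * invPoch n k
      * pow (- 1#) k
      * qz (((+ (n ℕ.* k)) -ℤ (+ (suc k C 2))) +ℤ (+ (p ℕ.* (k ℕ.* k ℕ.+ k))))
      * α k)

-- Write N = n - 1 and w j = q^{j(j+1)}.  Bailey's lemma with a = q and ρ₁, ρ₂ → ∞ turns a
-- Bailey pair (α, β) into (w k αₖ, β′) with β′ₙ = Σⱼ w j βⱼ / (q)ₙ₋ⱼ.  Summing the left-hand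
-- side over its top index first replaces β by β′ and p by p - 1, so the left-hand side is the
-- N-th term of the p-fold iterate of β ↦ β′; by the resulting Bailey chain this equals
-- Σₖ q^{pk(k+1)} αₖ / ((q)_{N-k} (q²)_{N+k}), which is the right-hand side once
-- (q)_N / (q)_{N-k} = (q^{-N})ₖ (-1)^k q^{Nk - k(k-1)/2} is inserted.
-- Bailey's lemma itself rests on the kernel identity
--   Σ_{r ≤ d} q^{(k+r)(k+r+1)} / ((q)_{d-r} (q)_r (q²)_{2k+r}) = q^{k(k+1)} / ((q)_d (q²)_{2k+d}),
-- the case x = q^{2k+1} of the polynomial identity Σ_{r ≤ m} [m r] q^{r²} x^r (x q^{r+1})_{m-r} = 1,
-- which follows by induction on m from the q-Pascal rule.

module Submission where

open import Defs
open import Level using (Level)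
open import Algebra.Bundles using (CommutativeRing)
import Algebra.Solver.Ring
import Algebra.Solver.Ring.AlmostCommutativeRing as ACR
open import Data.Maybe using (Maybe; just; nothing)
open import Data.Nat as ℕ using (ℕ; zero; suc; _∸_; _≤_; _<_; s≤s)
import Data.Nat.Properties as ℕ
open import Data.Nat.Combinatorics using (_C_; nCk+nC[k+1]≡[n+1]C[k+1]; nC1≡n)
open import Data.Nat.GeneralisedArithmetic using (iterate)
open import Data.Nat.Tactic.RingSolver using (solve-∀)
open import Data.Integer as ℤ using (ℤ; +_; -[1+_]; _⊖_)
import Data.Integer.Properties as ℤ
import Data.Integer.Tactic.RingSolver as ℤ-Solver
open import Data.Sign as Sign using ()
open import Data.List using (List; []; _∷_; map; concatMap; _++_)
import Data.List.Properties as List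
open import Data.Sum using (inj₁; inj₂)
open import Function using (_∘_)
open import Relation.Nullary using (yes; no)
open import Relation.Binary.PropositionalEquality as P using (_≡_)

-- Coefficients in ℤ let the ring solver decide identities involving subtraction.  The
-- TC-optimised multiple makes fromℤ (+ 1) definitionally 1#, so `con (+ 1)` is 1# itself.
module IntegerCoefficients {c ℓ} (R : CommutativeRing c ℓ) where
  open CommutativeRing R
  open import Algebra.Properties.Semiring.Mult.TCOptimised semiring using (_×_; 1+×; ×-homo-+; ×1-homo-*)
  open import Algebra.Properties.Ring ring using (-0#≈0#; -‿involutive; -‿+-comm; -‿distribˡ-*; -‿distribʳ-*)
  open import Algebra.Properties.AbelianGroup +-abelianGroup using (xyx⁻¹≈y)
  open import Relation.Binary.Reasoning.Setoid setoid

  fromℤ : ℤ → Carrier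
  fromℤ (+ n) = n × 1#
  fromℤ -[1+ n ] = - (suc n × 1#)

  fromℤ-⊖ : ∀ m n → fromℤ (m ⊖ n) ≈ m × 1# - n × 1#
  fromℤ-⊖ m zero = sym (trans (+-congˡ -0#≈0#) (+-identityʳ _))
  fromℤ-⊖ zero (suc n) = sym (+-identityˡ _)
  fromℤ-⊖ (suc m) (suc n) = begin
    fromℤ (suc m ⊖ suc n)              ≡⟨ P.cong fromℤ (ℤ.[1+m]⊖[1+n]≡m⊖n m n) ⟩
    fromℤ (m ⊖ n)                      ≈⟨ fromℤ-⊖ m n ⟩
    m × 1# - n × 1#                    ≈⟨ +-congʳ (xyx⁻¹≈y 1# (m × 1#)) ⟨
    1# + m × 1# - 1# - n × 1#          ≈⟨ +-assoc _ _ _ ⟩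
    1# + m × 1# + (- 1# - n × 1#)      ≈⟨ +-congˡ (-‿+-comm 1# (n × 1#)) ⟩
    1# + m × 1# - (1# + n × 1#)        ≈⟨ +-cong (1+× m 1#) (-‿cong (1+× n 1#)) ⟨
    suc m × 1# - suc n × 1#            ∎

  fromℤ-+ : ∀ i j → fromℤ (i ℤ.+ j) ≈ fromℤ i + fromℤ j
  fromℤ-+ (+ m) (+ n) = ×-homo-+ 1# m n
  fromℤ-+ (+ m) -[1+ n ] = fromℤ-⊖ m (suc n)
  fromℤ-+ -[1+ m ] (+ n) = trans (fromℤ-⊖ n (suc m)) (+-comm _ _)
  fromℤ-+ -[1+ m ] -[1+ n ] = begin
    - (suc (suc (m ℕ.+ n)) × 1#)       ≡⟨ P.cong (λ k → - (suc k × 1#)) (ℕ.+-suc m n) ⟨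
    - ((suc m ℕ.+ suc n) × 1#)         ≈⟨ -‿cong (×-homo-+ 1# (suc m) (suc n)) ⟩
    - (suc m × 1# + suc n × 1#)        ≈⟨ -‿+-comm _ _ ⟨
    - (suc m × 1#) + - (suc n × 1#)    ∎

  fromℤ-[-◃n] : ∀ n → fromℤ (Sign.- ℤ.◃ n) ≈ - (n × 1#)
  fromℤ-[-◃n] zero = sym -0#≈0#
  fromℤ-[-◃n] (suc n) = refl

  fromℤ-* : ∀ i j → fromℤ (i ℤ.* j) ≈ fromℤ i * fromℤ j
  fromℤ-* (+ m) (+ n) = begin
    fromℤ (Sign.+ ℤ.◃ m ℕ.* n)        ≡⟨ P.cong fromℤ (ℤ.+◃n≡+n (m ℕ.* n)) ⟩
    (m ℕ.* n) × 1#                    ≈⟨ ×1-homo-* m n ⟩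
    m × 1# * n × 1#                   ∎
  fromℤ-* (+ m) -[1+ n ] = begin
    fromℤ (Sign.- ℤ.◃ m ℕ.* suc n)    ≈⟨ fromℤ-[-◃n] (m ℕ.* suc n) ⟩
    - ((m ℕ.* suc n) × 1#)            ≈⟨ -‿cong (×1-homo-* m (suc n)) ⟩
    - (m × 1# * suc n × 1#)           ≈⟨ -‿distribʳ-* _ _ ⟩
    m × 1# * - (suc n × 1#)           ∎
  fromℤ-* -[1+ m ] (+ n) = begin
    fromℤ (Sign.- ℤ.◃ suc m ℕ.* n)    ≈⟨ fromℤ-[-◃n] (suc m ℕ.* n) ⟩
    - ((suc m ℕ.* n) × 1#)            ≈⟨ -‿cong (×1-homo-* (suc m) n) ⟩
    - (suc m × 1# * n × 1#)           ≈⟨ -‿distribˡ-* _ _ ⟩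
    - (suc m × 1#) * n × 1#           ∎
  fromℤ-* -[1+ m ] -[1+ n ] = begin
    (suc m ℕ.* suc n) × 1#            ≈⟨ ×1-homo-* (suc m) (suc n) ⟩
    suc m × 1# * suc n × 1#           ≈⟨ -‿involutive _ ⟨
    - - (suc m × 1# * suc n × 1#)     ≈⟨ -‿cong (-‿distribˡ-* _ _) ⟩
    - (- (suc m × 1#) * suc n × 1#)   ≈⟨ -‿distribʳ-* _ _ ⟩
    - (suc m × 1#) * - (suc n × 1#)   ∎

  fromℤ-‿ : ∀ i → fromℤ (ℤ.- i) ≈ - fromℤ i
  fromℤ-‿ (+ zero) = sym -0#≈0#
  fromℤ-‿ (+ suc n) = refl
  fromℤ-‿ -[1+ n ] = sym (-‿involutive _)

  homomorphism : ℤ.+-*-rawRing ACR.-Raw-AlmostCommutative⟶ ACR.fromCommutativeRing R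
  homomorphism = record
    { ⟦_⟧ = fromℤ ; +-homo = fromℤ-+ ; *-homo = fromℤ-* ; -‿homo = fromℤ-‿
    ; 0-homo = refl ; 1-homo = refl }

  fromℤ-≟ : ∀ i j → Maybe (fromℤ i ≈ fromℤ j)
  fromℤ-≟ i j with i ℤ.≟ j
  ... | yes P.refl = just refl
  ... | no _ = nothing

  open Algebra.Solver.Ring ℤ.+-*-rawRing (ACR.fromCommutativeRing R) homomorphism fromℤ-≟ public

module IndexArithmetic where
  open P.≡-Reasoning

  [1+n]∸m∸1≡n∸m : ∀ n m → suc n ∸ m ∸ 1 ≡ n ∸ m
  [1+n]∸m∸1≡n∸m n m = P.trans (ℕ.∸-+-assoc (suc n) m 1) (P.cong (suc n ∸_) (ℕ.+-comm m 1))

  topSum : ℕ → ℕ → ℕ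
  topSum n zero = 0
  topSum n (suc k) = topSum n k ℕ.+ (n ∸ k)

  topSum-+-C2 : ∀ n k → k ≤ n → topSum n k ℕ.+ suc k C 2 ≡ suc n ℕ.* k
  topSum-+-C2 n zero _ = P.sym (ℕ.*-zeroʳ (suc n))
  topSum-+-C2 n (suc k) k<n = begin
    topSum n k ℕ.+ (n ∸ k) ℕ.+ suc (suc k) C 2
      ≡⟨ P.cong (topSum n k ℕ.+ (n ∸ k) ℕ.+_) pascal ⟨
    topSum n k ℕ.+ (n ∸ k) ℕ.+ (suc k ℕ.+ suc k C 2)
      ≡⟨ rearrange (topSum n k) (n ∸ k) k (suc k C 2) ⟩
    topSum n k ℕ.+ suc k C 2 ℕ.+ suc (n ∸ k ℕ.+ k)
      ≡⟨ P.cong₂ (λ a b → a ℕ.+ suc b) (topSum-+-C2 n k (ℕ.<⇒≤ k<n)) (ℕ.m∸n+n≡m (ℕ.<⇒≤ k<n)) ⟩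
    suc n ℕ.* k ℕ.+ suc n
      ≡⟨ P.trans (ℕ.+-comm _ (suc n)) (P.sym (ℕ.*-suc (suc n) k)) ⟩
    suc n ℕ.* suc k ∎
    where
    pascal : suc k ℕ.+ suc k C 2 ≡ suc (suc k) C 2
    pascal = P.trans (P.cong (ℕ._+ suc k C 2) (P.sym (nC1≡n (suc k)))) (nCk+nC[k+1]≡[n+1]C[k+1] (suc k) 1)
    rearrange : ∀ t d k c → t ℕ.+ d ℕ.+ (suc k ℕ.+ c) ≡ t ℕ.+ c ℕ.+ suc (d ℕ.+ k)
    rearrange = solve-∀

  topSum-ℤ : ∀ n k → k ≤ n → + (suc n ℕ.* k) ℤ.- + (suc k C 2) ≡ + topSum n k
  topSum-ℤ n k k≤n = begin
    + (suc n ℕ.* k) ℤ.- + c            ≡⟨ ℤ.m-n≡m⊖n (suc n ℕ.* k) c ⟩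
    suc n ℕ.* k ℤ.⊖ c                  ≡⟨ ℤ.⊖-≥ c≤ ⟩
    + (suc n ℕ.* k ∸ c)                ≡⟨ P.cong (λ m → + (m ∸ c)) (topSum-+-C2 n k k≤n) ⟨
    + (topSum n k ℕ.+ c ∸ c)           ≡⟨ P.cong +_ (ℕ.m+n∸n≡m (topSum n k) c) ⟩
    + topSum n k                       ∎
    where
    c = suc k C 2
    c≤ : c ≤ suc n ℕ.* k
    c≤ = P.subst (c ≤_) (topSum-+-C2 n k k≤n) (ℕ.m≤n+m c (topSum n k))

  1-[1+n]+k : ∀ n k → k < n → + 1 ℤ.- + suc n ℤ.+ + k ≡ -[1+ n ∸ suc k ]
  1-[1+n]+k n k k<n = begin
    + 1 ℤ.- (+ 1 ℤ.+ + n) ℤ.+ + k   ≡⟨ ring (+ n) (+ k) ⟩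
    ℤ.- (+ n ℤ.- + k)               ≡⟨ P.cong ℤ.-_ (P.trans (ℤ.m-n≡m⊖n n k) (ℤ.⊖-≥ (ℕ.<⇒≤ k<n))) ⟩
    ℤ.- + (n ∸ k)                   ≡⟨ P.cong (λ m → ℤ.- + m) (ℕ.+-∸-assoc 1 k<n) ⟩
    -[1+ n ∸ suc k ]                ∎
    where
    ring : ∀ n k → + 1 ℤ.- (+ 1 ℤ.+ n) ℤ.+ k ≡ ℤ.- (n ℤ.- k)
    ring = ℤ-Solver.solve-∀

open IndexArithmetic

module BaileyChain {c ℓ} (R : CommutativeRing c ℓ)
  (q qi : CommutativeRing.Carrier R) (u : ℕ → CommutativeRing.Carrier R) where

  open CommutativeRing R
  open import Algebra.Properties.CommutativeSemiring.Exp commutativeSemiring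
    using (_^_; ^-homo-*; ^-assocʳ; ^-distrib-*)
  open QSeries R q qi u
  open IntegerCoefficients R
  open import Relation.Binary.Reasoning.Setoid setoid

  sumTo-cong : ∀ m {f g : ℕ → Carrier} → (∀ i → f i ≈ g i) → sumTo m f ≈ sumTo m g
  sumTo-cong zero f≈g = refl
  sumTo-cong (suc m) f≈g = +-cong (sumTo-cong m f≈g) (f≈g m)

  sumTo-cong-≤ : ∀ m {f g : ℕ → Carrier} → (∀ i → i ≤ m → f i ≈ g i) → sumTo (suc m) f ≈ sumTo (suc m) g
  sumTo-cong-≤ zero f≈g = +-congˡ (f≈g 0 ℕ.z≤n)
  sumTo-cong-≤ (suc m) f≈g =
    +-cong (sumTo-cong-≤ m (λ i i≤m → f≈g i (ℕ.m≤n⇒m≤1+n i≤m))) (f≈g (suc m) ℕ.≤-refl)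

  sumTo-distrib-+ : ∀ m (f g : ℕ → Carrier) → sumTo m (λ i → f i + g i) ≈ sumTo m f + sumTo m g
  sumTo-distrib-+ zero f g = sym (+-identityˡ 0#)
  sumTo-distrib-+ (suc m) f g = trans (+-congʳ (sumTo-distrib-+ m f g))
    (solve 4 (λ a b c d → (a :+ b) :+ (c :+ d) := (a :+ c) :+ (b :+ d)) refl _ _ _ _)

  *-distribˡ-sumTo : ∀ m x (f : ℕ → Carrier) → x * sumTo m f ≈ sumTo m (λ i → x * f i)
  *-distribˡ-sumTo zero x f = zeroʳ x
  *-distribˡ-sumTo (suc m) x f = trans (distribˡ x _ _) (+-congʳ (*-distribˡ-sumTo m x f))

  sumTo-head : ∀ m (f : ℕ → Carrier) → sumTo (suc m) f ≈ f 0 + sumTo m (f ∘ suc)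
  sumTo-head zero f = trans (+-identityˡ _) (sym (+-identityʳ _))
  sumTo-head (suc m) f = trans (+-congʳ (sumTo-head m f)) (+-assoc _ _ _)

  sumTo-reverse : ∀ m (f : ℕ → Carrier) → sumTo (suc m) f ≈ sumTo (suc m) (λ s → f (m ∸ s))
  sumTo-reverse zero f = refl
  sumTo-reverse (suc m) f = begin
    sumTo (suc m) f + f (suc m)                    ≈⟨ +-congʳ (sumTo-reverse m f) ⟩
    sumTo (suc m) (λ s → f (m ∸ s)) + f (suc m)    ≈⟨ +-comm _ _ ⟩
    f (suc m) + sumTo (suc m) (λ s → f (m ∸ s))    ≈⟨ sumTo-head (suc m) (λ s → f (suc m ∸ s)) ⟨
    sumTo (suc (suc m)) (λ s → f (suc m ∸ s))      ∎

  sumTo-triangle : ∀ n (F : ℕ → ℕ → Carrier) →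
    sumTo n (λ i → sumTo (suc i) (F i)) ≈ sumTo n (λ j → sumTo (n ∸ j) (λ s → F (j ℕ.+ s) j))
  sumTo-triangle zero F = refl
  sumTo-triangle (suc n) F = begin
    sumTo n (λ i → sumTo (suc i) (F i)) + sumTo (suc n) (F n)
      ≈⟨ +-congʳ (sumTo-triangle n F) ⟩
    sumTo n (λ j → sumTo (n ∸ j) (G j)) + sumTo (suc n) (F n)
      ≈⟨ +-congʳ (trans (+-congˡ (reflexive (P.cong (λ k → sumTo k (G n)) (ℕ.n∸n≡0 n)))) (+-identityʳ _)) ⟨
    sumTo (suc n) (λ j → sumTo (n ∸ j) (G j)) + sumTo (suc n) (F n)
      ≈⟨ sumTo-distrib-+ (suc n) _ _ ⟨
    sumTo (suc n) (λ j → sumTo (n ∸ j) (G j) + F n j)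
      ≈⟨ sumTo-cong-≤ n (λ j j≤n → sym (extend j j≤n)) ⟩
    sumTo (suc n) (λ j → sumTo (suc n ∸ j) (G j)) ∎
    where
    G : ℕ → ℕ → Carrier
    G j s = F (j ℕ.+ s) j
    extend : ∀ j → j ≤ n → sumTo (suc n ∸ j) (G j) ≈ sumTo (n ∸ j) (G j) + F n j
    extend j j≤n = begin
      sumTo (suc n ∸ j) (G j)            ≡⟨ P.cong (λ k → sumTo k (G j)) (ℕ.+-∸-assoc 1 j≤n) ⟩
      sumTo (n ∸ j) (G j) + G j (n ∸ j)  ≡⟨ P.cong (λ k → sumTo (n ∸ j) (G j) + F k j) (ℕ.m+[n∸m]≡n j≤n) ⟩
      sumTo (n ∸ j) (G j) + F n j        ∎

  prodTo-cong : ∀ m {f g : ℕ → Carrier} → (∀ i → f i ≈ g i) → prodTo m f ≈ prodTo m g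
  prodTo-cong zero f≈g = refl
  prodTo-cong (suc m) f≈g = *-cong (prodTo-cong m f≈g) (f≈g m)

  prodTo-distrib-* : ∀ m (f g : ℕ → Carrier) → prodTo m f * prodTo m g ≈ prodTo m (λ i → f i * g i)
  prodTo-distrib-* zero f g = *-identityˡ 1#
  prodTo-distrib-* (suc m) f g = trans
    (solve 4 (λ a b c d → (a :* b) :* (c :* d) := (a :* c) :* (b :* d)) refl _ _ _ _)
    (*-congʳ (prodTo-distrib-* m f g))

  prodTo-1 : ∀ m {f : ℕ → Carrier} → (∀ i → f i ≈ 1#) → prodTo m f ≈ 1#
  prodTo-1 zero f≈1 = refl
  prodTo-1 (suc m) f≈1 = trans (*-cong (prodTo-1 m f≈1) (f≈1 m)) (*-identityˡ 1#)

  prodTo-split : ∀ a b (f : ℕ → Carrier) → prodTo (a ℕ.+ b) f ≈ prodTo a f * prodTo b (λ i → f (a ℕ.+ i))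
  prodTo-split a zero f = trans (reflexive (P.cong (λ k → prodTo k f) (ℕ.+-identityʳ a))) (sym (*-identityʳ _))
  prodTo-split a (suc b) f = begin
    prodTo (a ℕ.+ suc b) f                                ≡⟨ P.cong (λ k → prodTo k f) (ℕ.+-suc a b) ⟩
    prodTo (a ℕ.+ b) f * f (a ℕ.+ b)                      ≈⟨ *-congʳ (prodTo-split a b f) ⟩
    prodTo a f * prodTo b (λ i → f (a ℕ.+ i)) * f (a ℕ.+ b) ≈⟨ *-assoc _ _ _ ⟩
    prodTo a f * prodTo (suc b) (λ i → f (a ℕ.+ i))       ∎

  pow≡^ : ∀ x n → pow x n ≡ x ^ n
  pow≡^ x zero = P.refl
  pow≡^ x (suc n) = P.cong (x *_) (pow≡^ x n)

  pow-+ : ∀ x m n → pow x (m ℕ.+ n) ≈ pow x m * pow x n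
  pow-+ x m n rewrite pow≡^ x (m ℕ.+ n) | pow≡^ x m | pow≡^ x n = ^-homo-* x m n

  pow-* : ∀ x m n → pow (pow x m) n ≈ pow x (m ℕ.* n)
  pow-* x m n rewrite pow≡^ (pow x m) n | pow≡^ x m | pow≡^ x (m ℕ.* n) = ^-assocʳ x m n

  pow-distrib-* : ∀ x y n → pow (x * y) n ≈ pow x n * pow y n
  pow-distrib-* x y n rewrite pow≡^ (x * y) n | pow≡^ x n | pow≡^ y n = ^-distrib-* x y n

  pow-cong : ∀ x {m n} → m ≡ n → pow x m ≈ pow x n
  pow-cong x P.refl = refl

  sumList-++ : ∀ xs ys → sumList (xs ++ ys) ≈ sumList xs + sumList ys
  sumList-++ [] ys = sym (+-identityˡ _)
  sumList-++ (x ∷ xs) ys = trans (+-congˡ (sumList-++ xs ys)) (sym (+-assoc _ _ _))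

  sumList-concatMap : ∀ {A B : Set} (f : A → Carrier) (g : B → List A) xs →
    sumList (map f (concatMap g xs)) ≈ sumList (map (λ x → sumList (map f (g x))) xs)
  sumList-concatMap f g [] = refl
  sumList-concatMap f g (x ∷ xs) = begin
    sumList (map f (g x ++ concatMap g xs))               ≡⟨ P.cong sumList (List.map-++ f (g x) (concatMap g xs)) ⟩
    sumList (map f (g x) ++ map f (concatMap g xs))       ≈⟨ sumList-++ (map f (g x)) _ ⟩
    sumList (map f (g x)) + sumList (map f (concatMap g xs)) ≈⟨ +-congˡ (sumList-concatMap f g xs) ⟩
    sumList (map f (g x)) + sumList (map (λ x → sumList (map f (g x))) xs) ∎

  sumList-upto : ∀ b (f : ℕ → Carrier) → sumList (map f (upto b)) ≈ sumTo (suc b) f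
  sumList-upto zero f = trans (+-identityʳ _) (sym (+-identityˡ _))
  sumList-upto (suc b) f = begin
    f 0 + sumList (map f (map suc (upto b)))  ≡⟨ P.cong (λ xs → f 0 + sumList xs) (List.map-∘ (upto b)) ⟨
    f 0 + sumList (map (f ∘ suc) (upto b))    ≈⟨ +-congˡ (sumList-upto b (f ∘ suc)) ⟩
    f 0 + sumTo (suc b) (f ∘ suc)             ≈⟨ sumTo-head (suc b) f ⟨
    sumTo (suc (suc b)) f                     ∎

  *-distribˡ-sumList : ∀ {A : Set} x (f : A → Carrier) xs → x * sumList (map f xs) ≈ sumList (map (λ a → x * f a) xs)
  *-distribˡ-sumList x f [] = zeroʳ x
  *-distribˡ-sumList x f (a ∷ xs) = trans (distribˡ x _ _) (+-congˡ (*-distribˡ-sumList x f xs))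

  sumList-chains : ∀ p b (F : List ℕ → Carrier) →
    sumList (map F (chains (suc p) b)) ≈ sumTo (suc b) (λ m → sumList (map (F ∘ (m ∷_)) (chains p m)))
  sumList-chains p b F = begin
    sumList (map F (concatMap (λ m → map (m ∷_) (chains p m)) (upto b)))
      ≈⟨ sumList-concatMap F _ (upto b) ⟩
    sumList (map (λ m → sumList (map F (map (m ∷_) (chains p m)))) (upto b))
      ≈⟨ sumList-upto b _ ⟩
    sumTo (suc b) (λ m → sumList (map F (map (m ∷_) (chains p m))))
      ≈⟨ sumTo-cong (suc b) (λ m → reflexive (P.cong sumList (List.map-∘ (chains p m)))) ⟨
    sumTo (suc b) (λ m → sumList (map (F ∘ (m ∷_)) (chains p m))) ∎

  pairProd-irrelevant : ∀ n β β′ l → pairProd n β l ≡ pairProd n β′ l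
  pairProd-irrelevant n β β′ [] = P.refl
  pairProd-irrelevant n β β′ (b ∷ []) = P.refl
  pairProd-irrelevant n β β′ (b ∷ a ∷ l) = P.cong (wexp n β a * qbinom b a *_) (pairProd-irrelevant n β β′ (a ∷ l))

  -- [m r] via q-Pascal; unlike qbinom it needs no inverses.
  gaussian : ℕ → ℕ → Carrier
  gaussian m zero = 1#
  gaussian zero (suc r) = 0#
  gaussian (suc m) (suc r) = gaussian m (suc r) + pow q (m ∸ r) * gaussian m r

  gaussian-vanishes : ∀ {m r} → m < r → gaussian m r ≈ 0#
  gaussian-vanishes {zero} {suc r} _ = refl
  gaussian-vanishes {suc m} {suc r} (s≤s m<r) = begin
    gaussian m (suc r) + pow q (m ∸ r) * gaussian m r
      ≈⟨ +-cong (gaussian-vanishes (ℕ.m≤n⇒m≤1+n m<r)) (*-congˡ (gaussian-vanishes m<r)) ⟩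
    0# + pow q (m ∸ r) * 0#  ≈⟨ trans (+-identityˡ _) (zeroʳ _) ⟩
    0#                       ∎

  gaussian-diagonal : ∀ m → gaussian m m ≈ 1#
  gaussian-diagonal zero = refl
  gaussian-diagonal (suc m) = begin
    gaussian m (suc m) + pow q (m ∸ m) * gaussian m m
      ≈⟨ +-cong (gaussian-vanishes (ℕ.n<1+n m)) (*-cong (pow-cong q (ℕ.n∸n≡0 m)) (gaussian-diagonal m)) ⟩
    0# + 1# * 1#  ≈⟨ trans (+-identityˡ _) (*-identityˡ 1#) ⟩
    1#            ∎

  qfac-gaussian : ∀ m r → r ≤ m → qfac r * qfac (m ∸ r) * gaussian m r ≈ qfac m
  qfac-gaussian m zero _ = trans (*-identityʳ _) (*-identityˡ _)
  qfac-gaussian (suc m) (suc r) (s≤s r≤m) with ℕ.m≤n⇒m<n∨m≡n r≤m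
  ... | inj₂ P.refl = begin
    qfac (suc r) * qfac (r ∸ r) * gaussian (suc r) (suc r)
      ≈⟨ *-cong (*-congˡ (reflexive (P.cong qfac (ℕ.n∸n≡0 r)))) (gaussian-diagonal (suc r)) ⟩
    qfac (suc r) * 1# * 1#  ≈⟨ trans (*-identityʳ _) (*-identityʳ _) ⟩
    qfac (suc r)            ∎
  ... | inj₁ r<m = begin
    qfac (suc r) * qfac (m ∸ r) * (gaussian m (suc r) + pow q (m ∸ r) * gaussian m r)
      ≡⟨ P.cong (λ k → qfac (suc r) * qfac k * (gaussian m (suc r) + pow q k * gaussian m r)) m∸r≡1+s ⟩
    qfac (suc r) * qfac (suc s) * (gaussian m (suc r) + pow q (suc s) * gaussian m r)
      ≈⟨ solve 6 (λ a y b z c d → a :* (con (+ 1) :- y) :* (b :* (con (+ 1) :- z)) :* (c :+ z :* d)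
                  := a :* (con (+ 1) :- y) :* b :* c :* (con (+ 1) :- z)
                     :+ a :* (b :* (con (+ 1) :- z)) :* d :* ((con (+ 1) :- y) :* z))
           refl (qfac r) (pow q (suc r)) (qfac s) (pow q (suc s)) (gaussian m (suc r)) (gaussian m r) ⟩
    qfac (suc r) * qfac s * gaussian m (suc r) * (1# − pow q (suc s))
      + qfac r * qfac (suc s) * gaussian m r * ((1# − pow q (suc r)) * pow q (suc s))
      ≈⟨ +-cong (*-congʳ (qfac-gaussian m (suc r) r<m)) (*-congʳ lower) ⟩
    qfac m * (1# − pow q (suc s)) + qfac m * ((1# − pow q (suc r)) * pow q (suc s))
      ≈⟨ solve 3 (λ a y z → a :* (con (+ 1) :- z) :+ a :* ((con (+ 1) :- y) :* z) := a :* (con (+ 1) :- y :* z))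
           refl (qfac m) (pow q (suc r)) (pow q (suc s)) ⟩
    qfac m * (1# − (pow q (suc r) * pow q (suc s)))
      ≈⟨ *-congˡ (+-congˡ (-‿cong (trans (sym (pow-+ q (suc r) (suc s))) (pow-cong q exponent)))) ⟩
    qfac m * (1# − pow q (suc m)) ∎
    where
    s = m ∸ suc r
    m∸r≡1+s : m ∸ r ≡ suc s
    m∸r≡1+s = ℕ.+-∸-assoc 1 r<m
    lower : qfac r * qfac (suc s) * gaussian m r ≈ qfac m
    lower = trans (reflexive (P.cong (λ k → qfac r * qfac k * gaussian m r) (P.sym m∸r≡1+s)))
                  (qfac-gaussian m r (ℕ.<⇒≤ r<m))
    exponent : suc r ℕ.+ suc s ≡ suc m
    exponent = P.cong suc (P.trans (P.cong (r ℕ.+_) (P.sym m∸r≡1+s)) (ℕ.m+[n∸m]≡n r≤m))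

  unityFactor : Carrier → ℕ → ℕ → Carrier
  unityFactor x r i = 1# − (x * pow q (r ℕ.+ suc i))

  unityTerm : ℕ → Carrier → ℕ → Carrier
  unityTerm m x r = gaussian m r * pow q (r ℕ.* r) * pow x r * prodTo (m ∸ r) (unityFactor x r)

  private
    zero-product : ∀ {a} b c d → a ≈ 0# → a * b * c * d ≈ 0#
    zero-product b c d a≈0 = trans (*-congʳ (*-congʳ (*-congʳ a≈0)))
      (solve 3 (λ b c d → con (+ 0) :* b :* c :* d := con (+ 0)) refl b c d)

  -- The two parts of unityTerm (suc m) x (suc r) under q-Pascal.
  unityTerm-upper : ∀ m x r → r ≤ m →
    gaussian m (suc r) * pow q (suc r ℕ.* suc r) * pow x (suc r) * prodTo (m ∸ r) (unityFactor x (suc r))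
      ≈ (1# − (x * pow q (suc m))) * unityTerm m x (suc r)
  unityTerm-upper m x r r≤m with ℕ.m≤n⇒m<n∨m≡n r≤m
  ... | inj₂ P.refl = trans (zero-product _ _ _ (gaussian-vanishes (ℕ.n<1+n r)))
    (sym (trans (*-congˡ (zero-product _ _ _ (gaussian-vanishes (ℕ.n<1+n r)))) (zeroʳ _)))
  ... | inj₁ r<m = begin
    g * Q * X * prodTo (m ∸ r) F          ≡⟨ P.cong (λ k → g * Q * X * prodTo k F) (ℕ.+-∸-assoc 1 r<m) ⟩
    g * Q * X * (prodTo s F * F s)        ≈⟨ *-congˡ (*-congˡ (+-congˡ (-‿cong (*-congˡ (pow-cong q exponent))))) ⟩
    g * Q * X * (prodTo s F * (1# − y))   ≈⟨ solve 5 (λ g Q X P y → g :* Q :* X :* (P :* (con (+ 1) :- y))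
                                                := (con (+ 1) :- y) :* (g :* Q :* X :* P)) refl g Q X (prodTo s F) y ⟩
    (1# − y) * (g * Q * X * prodTo s F)   ∎
    where
    g = gaussian m (suc r)
    Q = pow q (suc r ℕ.* suc r)
    X = pow x (suc r)
    F = unityFactor x (suc r)
    s = m ∸ suc r
    y = x * pow q (suc m)
    exponent : suc r ℕ.+ suc s ≡ suc m
    exponent = P.cong suc (P.trans (P.cong (r ℕ.+_) (P.sym (ℕ.+-∸-assoc 1 r<m))) (ℕ.m+[n∸m]≡n r≤m))

  unityTerm-lower : ∀ m x r → r ≤ m →
    pow q (m ∸ r) * gaussian m r * pow q (suc r ℕ.* suc r) * pow x (suc r) * prodTo (m ∸ r) (unityFactor x (suc r))
      ≈ x * pow q (suc m) * unityTerm m (x * q) r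
  unityTerm-lower m x r r≤m = begin
    pow q (m ∸ r) * g * pow q (suc r ℕ.* suc r) * (x * pow x r) * prodTo (m ∸ r) (unityFactor x (suc r))
      ≈⟨ *-congˡ (prodTo-cong (m ∸ r) (λ i → +-congˡ (-‿cong (sym (*-assoc x q _))))) ⟩
    pow q (m ∸ r) * g * pow q (suc r ℕ.* suc r) * (x * pow x r) * P
      ≈⟨ solve 6 (λ a g b x X P → a :* g :* b :* (x :* X) :* P := (a :* b) :* (x :* g :* X :* P))
           refl (pow q (m ∸ r)) g (pow q (suc r ℕ.* suc r)) x (pow x r) P ⟩
    (pow q (m ∸ r) * pow q (suc r ℕ.* suc r)) * (x * g * pow x r * P)
      ≈⟨ *-congʳ exponents ⟩
    pow q (suc m) * pow q (r ℕ.* r) * pow q r * (x * g * pow x r * P)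
      ≈⟨ solve 7 (λ a b c x g X P → a :* b :* c :* (x :* g :* X :* P) := x :* a :* (g :* b :* (X :* c) :* P))
           refl (pow q (suc m)) (pow q (r ℕ.* r)) (pow q r) x g (pow x r) P ⟩
    x * pow q (suc m) * (g * pow q (r ℕ.* r) * (pow x r * pow q r) * P)
      ≈⟨ *-congˡ (*-congʳ (*-congˡ (pow-distrib-* x q r))) ⟨
    x * pow q (suc m) * unityTerm m (x * q) r ∎
    where
    g = gaussian m r
    P = prodTo (m ∸ r) (unityFactor (x * q) r)
    exponent : ∀ d r → d ℕ.+ suc r ℕ.* suc r ≡ suc (d ℕ.+ r) ℕ.+ r ℕ.* r ℕ.+ r
    exponent = solve-∀
    exponents : pow q (m ∸ r) * pow q (suc r ℕ.* suc r) ≈ pow q (suc m) * pow q (r ℕ.* r) * pow q r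
    exponents = begin
      pow q (m ∸ r) * pow q (suc r ℕ.* suc r)          ≈⟨ pow-+ q (m ∸ r) _ ⟨
      pow q (m ∸ r ℕ.+ suc r ℕ.* suc r)                ≡⟨ P.cong (pow q) (exponent (m ∸ r) r) ⟩
      pow q (suc (m ∸ r ℕ.+ r) ℕ.+ r ℕ.* r ℕ.+ r)       ≡⟨ P.cong (λ k → pow q (suc k ℕ.+ r ℕ.* r ℕ.+ r)) (ℕ.m∸n+n≡m r≤m) ⟩
      pow q (suc m ℕ.+ r ℕ.* r ℕ.+ r)                  ≈⟨ pow-+ q (suc m ℕ.+ r ℕ.* r) r ⟩
      pow q (suc m ℕ.+ r ℕ.* r) * pow q r              ≈⟨ *-congʳ (pow-+ q (suc m) (r ℕ.* r)) ⟩
      pow q (suc m) * pow q (r ℕ.* r) * pow q r        ∎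

  sumTo-unityTerm : ∀ m x → sumTo (suc m) (unityTerm m x) ≈ 1#
  sumTo-unityTerm zero x = solve 0 (con (+ 0) :+ con (+ 1) :* con (+ 1) :* con (+ 1) :* con (+ 1) := con (+ 1)) refl
  sumTo-unityTerm (suc m) x = begin
    sumTo (suc (suc m)) (unityTerm (suc m) x)
      ≈⟨ sumTo-head (suc m) (unityTerm (suc m) x) ⟩
    unityTerm (suc m) x 0 + sumTo (suc m) (unityTerm (suc m) x ∘ suc)
      ≈⟨ +-cong unityTerm-suc-zero (sumTo-cong-≤ m unityTerm-suc-suc) ⟩
    (1# − y) * T x 0 + sumTo (suc m) (λ r → (1# − y) * T x (suc r) + y * T (x * q) r)
      ≈⟨ +-congˡ (trans (sumTo-distrib-+ (suc m) _ _)
                         (sym (+-cong (*-distribˡ-sumTo (suc m) _ _) (*-distribˡ-sumTo (suc m) y _)))) ⟩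
    (1# − y) * T x 0 + ((1# − y) * sumTo (suc m) (T x ∘ suc) + y * sumTo (suc m) (T (x * q)))
      ≈⟨ +-congˡ (+-congˡ (*-congˡ (sumTo-unityTerm m (x * q)))) ⟩
    (1# − y) * T x 0 + ((1# − y) * sumTo (suc m) (T x ∘ suc) + y * 1#)
      ≈⟨ solve 4 (λ y a b c → (con (+ 1) :- y) :* a :+ ((con (+ 1) :- y) :* b :+ y :* c)
                   := (con (+ 1) :- y) :* (a :+ b) :+ y :* c) refl y _ _ _ ⟩
    (1# − y) * (T x 0 + sumTo (suc m) (T x ∘ suc)) + y * 1#
      ≈⟨ +-congʳ (*-congˡ (sumTo-head (suc m) (T x))) ⟨
    (1# − y) * (sumTo (suc m) (T x) + T x (suc m)) + y * 1#
      ≈⟨ +-congʳ (*-congˡ (+-cong (sumTo-unityTerm m x) (zero-product _ _ _ (gaussian-vanishes (ℕ.n<1+n m))))) ⟩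
    (1# − y) * (1# + 0#) + y * 1#
      ≈⟨ solve 1 (λ y → (con (+ 1) :- y) :* (con (+ 1) :+ con (+ 0)) :+ y :* con (+ 1) := con (+ 1)) refl y ⟩
    1# ∎
    where
    T = unityTerm m
    y = x * pow q (suc m)
    unityTerm-suc-zero : unityTerm (suc m) x 0 ≈ (1# − y) * T x 0
    unityTerm-suc-zero = solve 2 (λ P y → con (+ 1) :* con (+ 1) :* con (+ 1) :* (P :* (con (+ 1) :- y))
                                   := (con (+ 1) :- y) :* (con (+ 1) :* con (+ 1) :* con (+ 1) :* P))
                           refl (prodTo m (unityFactor x 0)) y
    unityTerm-suc-suc : ∀ r → r ≤ m → unityTerm (suc m) x (suc r) ≈ (1# − y) * T x (suc r) + y * T (x * q) r
    unityTerm-suc-suc r r≤m = begin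
      (g₁ + pow q (m ∸ r) * g₀) * Q * X * P
        ≈⟨ solve 6 (λ g₁ a g₀ Q X P → (g₁ :+ a :* g₀) :* Q :* X :* P := g₁ :* Q :* X :* P :+ a :* g₀ :* Q :* X :* P)
             refl g₁ (pow q (m ∸ r)) g₀ Q X P ⟩
      g₁ * Q * X * P + pow q (m ∸ r) * g₀ * Q * X * P
        ≈⟨ +-cong (unityTerm-upper m x r r≤m) (unityTerm-lower m x r r≤m) ⟩
      (1# − y) * T x (suc r) + y * T (x * q) r ∎
      where
      g₁ = gaussian m (suc r)
      g₀ = gaussian m r
      Q = pow q (suc r ℕ.* suc r)
      X = pow x (suc r)
      P = prodTo (m ∸ r) (unityFactor x (suc r))

  -- Bailey's lemma at a = q with ρ₁, ρ₂ → ∞ maps (αₖ, βₙ) to (weight k * αₖ, baileyβ β n);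
  -- baileyKernel n k = 1 / ((q)ₙ₋ₖ (q²)ₙ₊ₖ).
  weight : ℕ → Carrier
  weight j = pow q (j ℕ.* suc j)

  baileyKernel : ℕ → ℕ → Carrier
  baileyKernel n k = invQfac (n ∸ k) * invPoch 1 (n ℕ.+ k)

  baileyβ : (ℕ → Carrier) → ℕ → Carrier
  baileyβ β n = sumTo (suc n) (λ j → weight j * invQfac (n ∸ j) * β j)

  baileyβ-reversed : ∀ β n → baileyβ β n ≈ sumTo (suc n) (λ s → weight (n ∸ s) * β (n ∸ s) * invQfac s)
  baileyβ-reversed β n = trans (sumTo-reverse n _) (sumTo-cong-≤ n (λ s s≤n → trans
    (reflexive (P.cong (λ e → weight (n ∸ s) * invQfac e * β (n ∸ s)) (ℕ.m∸[m∸n]≡n s≤n)))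
    (solve 3 (λ w i b → w :* i :* b := w :* b :* i) refl _ _ _)))

  weight-+ : ∀ k r → weight k * pow q (r ℕ.* r) * pow (pow q (suc (k ℕ.+ k))) r ≈ weight (k ℕ.+ r)
  weight-+ k r = begin
    weight k * pow q (r ℕ.* r) * pow (pow q (suc (k ℕ.+ k))) r
      ≈⟨ *-cong (sym (pow-+ q (k ℕ.* suc k) (r ℕ.* r))) (pow-* q (suc (k ℕ.+ k)) r) ⟩
    pow q (k ℕ.* suc k ℕ.+ r ℕ.* r) * pow q (suc (k ℕ.+ k) ℕ.* r)
      ≈⟨ pow-+ q (k ℕ.* suc k ℕ.+ r ℕ.* r) (suc (k ℕ.+ k) ℕ.* r) ⟨
    pow q (k ℕ.* suc k ℕ.+ r ℕ.* r ℕ.+ suc (k ℕ.+ k) ℕ.* r)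
      ≡⟨ P.cong (pow q) (exponent k r) ⟩
    weight (k ℕ.+ r) ∎
    where
    exponent : ∀ k r → k ℕ.* suc k ℕ.+ r ℕ.* r ℕ.+ suc (k ℕ.+ k) ℕ.* r ≡ (k ℕ.+ r) ℕ.* suc (k ℕ.+ r)
    exponent = solve-∀

  IsBaileyPairRelq-congˡ : ∀ {α α′ β} → (∀ k → α k ≈ α′ k) → IsBaileyPairRelq α β → IsBaileyPairRelq α′ β
  IsBaileyPairRelq-congˡ α≈α′ αβ n = trans (αβ n) (sumTo-cong (suc n) (λ k → *-congʳ (α≈α′ k)))

  -- (q)ₙ / (q)ₙ₋ₖ
  topQfac : ℕ → ℕ → Carrier
  topQfac n k = prodTo k (λ j → 1# − pow q (n ∸ j))

  module _ (q·qi≈1 : q * qi ≈ 1#) where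

    pow-qi-q : ∀ e → pow qi e * pow q e ≈ 1#
    pow-qi-q zero = *-identityˡ 1#
    pow-qi-q (suc e) = begin
      qi * pow qi e * (q * pow q e)     ≈⟨ solve 4 (λ a b x y → a :* x :* (b :* y) := b :* a :* (x :* y)) refl qi q _ _ ⟩
      q * qi * (pow qi e * pow q e)     ≈⟨ *-cong q·qi≈1 (pow-qi-q e) ⟩
      1# * 1#                           ≈⟨ *-identityˡ 1# ⟩
      1#                                ∎

    poch-reflection : ∀ n k → k ≤ n → poch (+ 1 ℤ.- + suc n) k * pow (- 1#) k * pow q (topSum n k) ≈ topQfac n k
    poch-reflection n zero _ = trans (*-identityʳ _) (*-identityʳ _)
    poch-reflection n (suc k) k<n = begin
      poch b k * (1# − qz (b ℤ.+ + k)) * (- 1# * pow (- 1#) k) * pow q (topSum n k ℕ.+ (n ∸ k))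
        ≈⟨ *-cong (*-congʳ (*-congˡ (+-congˡ (-‿cong (reflexive (P.cong qz (1-[1+n]+k n k k<n)))))))
                  (trans (pow-+ q (topSum n k) (n ∸ k)) (*-congˡ (pow-cong q n∸k≡e))) ⟩
      poch b k * (1# − pow qi e) * (- 1# * pow (- 1#) k) * (pow q (topSum n k) * pow q e)
        ≈⟨ solve 5 (λ a x s z y → a :* (con (+ 1) :- x) :* (:- con (+ 1) :* s) :* (z :* y) := a :* s :* z :* (x :* y :- y))
             refl _ _ _ _ _ ⟩
      poch b k * pow (- 1#) k * pow q (topSum n k) * ((pow qi e * pow q e) − pow q e)
        ≈⟨ *-cong (poch-reflection n k (ℕ.<⇒≤ k<n)) (+-congʳ (pow-qi-q e)) ⟩
      topQfac n k * (1# − pow q e)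
        ≡⟨ P.cong (λ d → topQfac n k * (1# − pow q d)) n∸k≡e ⟨
      topQfac n (suc k) ∎
      where
      b = + 1 ℤ.- + suc n
      e = suc (n ∸ suc k)
      n∸k≡e : n ∸ k ≡ e
      n∸k≡e = ℕ.+-∸-assoc 1 k<n

  module _ (N : ℕ) where

    -- Σ over m ≥ n_{p-1} ≥ ⋯ ≥ n_1 of ∏ᵢ q^{(n-nᵢ-1)(n-nᵢ)} [n_{i+1} nᵢ], where n = N + 1 and
    -- n_p = m; the argument β of pairProd is a dummy.
    chainWeight : (ℕ → Carrier) → ℕ → ℕ → Carrier
    chainWeight β p m = sumList (map (λ c → pairProd (suc N) β (m ∷ c)) (chains p m))

    chainWeight-irrelevant : ∀ β β′ p m → chainWeight β p m ≡ chainWeight β′ p m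
    chainWeight-irrelevant β β′ p m =
      P.cong sumList (List.map-cong (λ c → pairProd-irrelevant (suc N) β β′ (m ∷ c)) (chains p m))

    chainWeight-suc : ∀ β p M →
      chainWeight β (suc p) M ≈ sumTo (suc M) (λ m → wexp (suc N) β m * qbinom M m * chainWeight β p m)
    chainWeight-suc β p M = trans (sumList-chains p M _)
      (sumTo-cong (suc M) (λ m → sym (*-distribˡ-sumList _ (λ c → pairProd (suc N) β (m ∷ c)) (chains p m))))

    wexp≈weight : ∀ β m → m ≤ N → wexp (suc N) β m ≈ weight (N ∸ m)
    wexp≈weight β m m≤N = pow-cong q (P.cong₂ ℕ._*_ ([1+n]∸m∸1≡n∸m N m) (ℕ.+-∸-assoc 1 m≤N))

    lhs-unfold : ∀ β p →
      lhs (suc N) β (suc p) ≈ sumTo (suc N) (λ m → weight (N ∸ m) * β (N ∸ m) * invQfac m * chainWeight β p m)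
    lhs-unfold β p = trans (sumList-chains p N (chainTerm (suc N) β))
      (sumTo-cong-≤ N (λ m m≤N → trans (sym (*-distribˡ-sumList _ (λ c → pairProd (suc N) β (m ∷ c)) (chains p m)))
                                          (*-congʳ (head m m≤N))))
      where
      head : ∀ m → m ≤ N → wexp (suc N) β m * β (suc N ∸ m ∸ 1) * invQfac m ≈ weight (N ∸ m) * β (N ∸ m) * invQfac m
      head m m≤N = *-congʳ (*-cong (wexp≈weight β m m≤N) (reflexive (P.cong β ([1+n]∸m∸1≡n∸m N m))))

    lhs-one : ∀ β → lhs (suc N) β 1 ≈ baileyβ β N
    lhs-one β = begin
      lhs (suc N) β 1
        ≈⟨ lhs-unfold β 0 ⟩
      sumTo (suc N) (λ m → weight (N ∸ m) * β (N ∸ m) * invQfac m * chainWeight β 0 m)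
        ≈⟨ sumTo-cong (suc N) (λ m → trans (*-congˡ (+-identityʳ 1#)) (*-identityʳ _)) ⟩
      sumTo (suc N) (λ m → weight (N ∸ m) * β (N ∸ m) * invQfac m)
        ≈⟨ baileyβ-reversed β N ⟨
      baileyβ β N ∎

  module _ (u-inverse : ∀ j → (1# − pow q (suc j)) * u j ≈ 1#) where

    poch-invPoch : ∀ s m → poch (+ suc s) m * invPoch s m ≈ 1#
    poch-invPoch s m = trans (prodTo-distrib-* m _ _) (prodTo-1 m (λ i → u-inverse (s ℕ.+ i)))

    qfac-invQfac : ∀ m → qfac m * invQfac m ≈ 1#
    qfac-invQfac = poch-invPoch 0

    gaussian-invQfac : ∀ m r → r ≤ m → gaussian m r * invQfac m ≈ invQfac r * invQfac (m ∸ r)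
    gaussian-invQfac m r r≤m = begin
      g * invQfac m
        ≈⟨ *-identityʳ _ ⟨
      g * invQfac m * 1#
        ≈⟨ *-congˡ (trans (*-cong (qfac-invQfac r) (qfac-invQfac (m ∸ r))) (*-identityˡ 1#)) ⟨
      g * invQfac m * (qfac r * invQfac r * (qfac (m ∸ r) * invQfac (m ∸ r)))
        ≈⟨ solve 6 (λ g i a ia b ib → g :* i :* (a :* ia :* (b :* ib)) := a :* b :* g :* i :* (ia :* ib))
             refl g (invQfac m) (qfac r) (invQfac r) (qfac (m ∸ r)) (invQfac (m ∸ r)) ⟩
      qfac r * qfac (m ∸ r) * g * invQfac m * (invQfac r * invQfac (m ∸ r))
        ≈⟨ *-congʳ (trans (*-congʳ (qfac-gaussian m r r≤m)) (qfac-invQfac m)) ⟩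
      1# * (invQfac r * invQfac (m ∸ r))
        ≈⟨ *-identityˡ _ ⟩
      invQfac r * invQfac (m ∸ r) ∎
      where g = gaussian m r

    unityFactor-invPoch : ∀ k d r → r ≤ d →
      prodTo (d ∸ r) (unityFactor (pow q (suc (k ℕ.+ k))) r) * invPoch 1 (k ℕ.+ d ℕ.+ k) ≈ invPoch 1 (k ℕ.+ r ℕ.+ k)
    unityFactor-invPoch k d r r≤d = begin
      prodTo (d ∸ r) (unityFactor x r) * invPoch 1 (k ℕ.+ d ℕ.+ k)
        ≡⟨ P.cong (λ n → prodTo (d ∸ r) (unityFactor x r) * invPoch 1 n) length ⟩
      prodTo (d ∸ r) (unityFactor x r) * invPoch 1 (a ℕ.+ (d ∸ r))
        ≈⟨ *-cong (prodTo-cong (d ∸ r) (λ i → +-congˡ (-‿cong factor))) (prodTo-split a (d ∸ r) _) ⟩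
      poch (+ suc (suc a)) (d ∸ r) * (invPoch 1 a * invPoch (suc a) (d ∸ r))
        ≈⟨ solve 3 (λ p a b → p :* (a :* b) := a :* (p :* b)) refl _ _ _ ⟩
      invPoch 1 a * (poch (+ suc (suc a)) (d ∸ r) * invPoch (suc a) (d ∸ r))
        ≈⟨ trans (*-congˡ (poch-invPoch (suc a) (d ∸ r))) (*-identityʳ _) ⟩
      invPoch 1 a ∎
      where
      x = pow q (suc (k ℕ.+ k))
      a = k ℕ.+ r ℕ.+ k
      length : k ℕ.+ d ℕ.+ k ≡ a ℕ.+ (d ∸ r)
      length = P.trans (P.cong (λ n → k ℕ.+ n ℕ.+ k) (P.sym (ℕ.m+[n∸m]≡n r≤d))) (rearrange k r (d ∸ r))
        where
        rearrange : ∀ k r e → k ℕ.+ (r ℕ.+ e) ℕ.+ k ≡ k ℕ.+ r ℕ.+ k ℕ.+ e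
        rearrange = solve-∀
      factor : ∀ {i} → x * pow q (r ℕ.+ suc i) ≈ pow q (suc (suc a ℕ.+ i))
      factor {i} = trans (sym (pow-+ q (suc (k ℕ.+ k)) (r ℕ.+ suc i))) (pow-cong q (exponent k r i))
        where
        exponent : ∀ k r i → suc (k ℕ.+ k) ℕ.+ (r ℕ.+ suc i) ≡ suc (suc (k ℕ.+ r ℕ.+ k ℕ.+ i))
        exponent = solve-∀

    sumTo-weight-baileyKernel : ∀ k d →
      sumTo (suc d) (λ r → weight (k ℕ.+ r) * invQfac (d ∸ r) * baileyKernel (k ℕ.+ r) k)
        ≈ weight k * baileyKernel (k ℕ.+ d) k
    -- The r-th term is c₀ * unityTerm d (q^{2k+1}) r with c₀ independent of r.
    sumTo-weight-baileyKernel k d = begin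
      sumTo (suc d) (λ r → weight (k ℕ.+ r) * invQfac (d ∸ r) * baileyKernel (k ℕ.+ r) k)
        ≈⟨ sumTo-cong-≤ d term ⟩
      sumTo (suc d) (λ r → c₀ * unityTerm d x r)
        ≈⟨ *-distribˡ-sumTo (suc d) c₀ (unityTerm d x) ⟨
      c₀ * sumTo (suc d) (unityTerm d x)
        ≈⟨ trans (*-congˡ (sumTo-unityTerm d x)) (*-identityʳ c₀) ⟩
      weight k * invQfac d * invPoch 1 (k ℕ.+ d ℕ.+ k)
        ≈⟨ *-assoc _ _ _ ⟩
      weight k * (invQfac d * invPoch 1 (k ℕ.+ d ℕ.+ k))
        ≡⟨ P.cong (λ e → weight k * (invQfac e * invPoch 1 (k ℕ.+ d ℕ.+ k))) (ℕ.m+n∸m≡n k d) ⟨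
      weight k * baileyKernel (k ℕ.+ d) k ∎
      where
      x = pow q (suc (k ℕ.+ k))
      c₀ = weight k * invQfac d * invPoch 1 (k ℕ.+ d ℕ.+ k)
      term : ∀ r → r ≤ d → weight (k ℕ.+ r) * invQfac (d ∸ r) * baileyKernel (k ℕ.+ r) k ≈ c₀ * unityTerm d x r
      term r r≤d = begin
        weight (k ℕ.+ r) * invQfac (d ∸ r) * (invQfac (k ℕ.+ r ∸ k) * invPoch 1 (k ℕ.+ r ℕ.+ k))
          ≡⟨ P.cong (λ e → weight (k ℕ.+ r) * invQfac (d ∸ r) * (invQfac e * invPoch 1 (k ℕ.+ r ℕ.+ k))) (ℕ.m+n∸m≡n k r) ⟩
        weight (k ℕ.+ r) * invQfac (d ∸ r) * (invQfac r * invPoch 1 (k ℕ.+ r ℕ.+ k))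
          ≈⟨ solve 4 (λ w a b c → w :* a :* (b :* c) := w :* (b :* a) :* c) refl _ _ _ _ ⟩
        weight (k ℕ.+ r) * (invQfac r * invQfac (d ∸ r)) * invPoch 1 (k ℕ.+ r ℕ.+ k)
          ≈⟨ *-cong (*-cong (weight-+ k r) (gaussian-invQfac d r r≤d)) (unityFactor-invPoch k d r r≤d) ⟨
        weight k * pow q (r ℕ.* r) * pow x r * (gaussian d r * invQfac d)
          * (prodTo (d ∸ r) (unityFactor x r) * invPoch 1 (k ℕ.+ d ℕ.+ k))
          ≈⟨ solve 7 (λ w Q X g i P j → w :* Q :* X :* (g :* i) :* (P :* j) := w :* i :* j :* (g :* Q :* X :* P))
               refl (weight k) (pow q (r ℕ.* r)) (pow x r) (gaussian d r) (invQfac d)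
               (prodTo (d ∸ r) (unityFactor x r)) (invPoch 1 (k ℕ.+ d ℕ.+ k)) ⟩
        c₀ * unityTerm d x r ∎

    baileyLemma : ∀ {α β} → IsBaileyPairRelq α β → IsBaileyPairRelq (λ k → weight k * α k) (baileyβ β)
    baileyLemma {α} {β} αβ n = begin
      sumTo (suc n) (λ j → weight j * invQfac (n ∸ j) * β j)
        ≈⟨ sumTo-cong (suc n) (λ j → trans (*-congˡ (αβ j)) (*-distribˡ-sumTo (suc j) _ _)) ⟩
      sumTo (suc n) (λ j → sumTo (suc j) (λ k → weight j * invQfac (n ∸ j) * (α k * baileyKernel j k)))
        ≈⟨ sumTo-triangle (suc n) _ ⟩
      sumTo (suc n) (λ k → sumTo (suc n ∸ k) (λ r → weight (k ℕ.+ r) * invQfac (n ∸ (k ℕ.+ r)) * (α k * baileyKernel (k ℕ.+ r) k)))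
        ≈⟨ sumTo-cong-≤ n column ⟩
      sumTo (suc n) (λ k → weight k * α k * baileyKernel n k) ∎
      where
      column : ∀ k → k ≤ n →
        sumTo (suc n ∸ k) (λ r → weight (k ℕ.+ r) * invQfac (n ∸ (k ℕ.+ r)) * (α k * baileyKernel (k ℕ.+ r) k))
          ≈ weight k * α k * baileyKernel n k
      column k k≤n = begin
        sumTo (suc n ∸ k) T
          ≡⟨ P.cong (λ e → sumTo e T) (ℕ.+-∸-assoc 1 k≤n) ⟩
        sumTo (suc d) T
          ≈⟨ sumTo-cong (suc d) factor-α ⟩
        sumTo (suc d) (λ r → α k * (weight (k ℕ.+ r) * invQfac (d ∸ r) * baileyKernel (k ℕ.+ r) k))
          ≈⟨ *-distribˡ-sumTo (suc d) (α k) _ ⟨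
        α k * sumTo (suc d) (λ r → weight (k ℕ.+ r) * invQfac (d ∸ r) * baileyKernel (k ℕ.+ r) k)
          ≈⟨ *-congˡ (sumTo-weight-baileyKernel k d) ⟩
        α k * (weight k * baileyKernel (k ℕ.+ d) k)
          ≡⟨ P.cong (λ e → α k * (weight k * baileyKernel e k)) (ℕ.m+[n∸m]≡n k≤n) ⟩
        α k * (weight k * baileyKernel n k)
          ≈⟨ solve 3 (λ a w K → a :* (w :* K) := w :* a :* K) refl _ _ _ ⟩
        weight k * α k * baileyKernel n k ∎
        where
        d = n ∸ k
        T : ℕ → Carrier
        T r = weight (k ℕ.+ r) * invQfac (n ∸ (k ℕ.+ r)) * (α k * baileyKernel (k ℕ.+ r) k)
        factor-α : ∀ r → T r ≈ α k * (weight (k ℕ.+ r) * invQfac (d ∸ r) * baileyKernel (k ℕ.+ r) k)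
        factor-α r = trans (solve 4 (λ w i a K → w :* i :* (a :* K) := a :* (w :* i :* K)) refl _ _ _ _)
          (*-congˡ (*-congʳ (*-congˡ (reflexive (P.cong invQfac (P.sym (ℕ.∸-+-assoc n k r)))))))

    baileyChain : ∀ {α β} → IsBaileyPairRelq α β →
      ∀ p → IsBaileyPairRelq (λ k → pow (weight k) p * α k) (iterate baileyβ β p)
    baileyChain αβ zero = IsBaileyPairRelq-congˡ (λ k → sym (*-identityˡ _)) αβ
    baileyChain αβ (suc p) =
      IsBaileyPairRelq-congˡ (λ k → solve 3 (λ w W a → W :* (w :* a) := w :* W :* a) refl _ _ _)
                             (baileyChain (baileyLemma αβ) p)

    module _ (N : ℕ) where

      lhs-step : ∀ β p → lhs (suc N) β (suc (suc p)) ≈ lhs (suc N) (baileyβ β) (suc p)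
      -- Summing over the top index first, with the next index m fixed, produces baileyβ β (N ∸ m).
      lhs-step β p = begin
        lhs (suc N) β (suc (suc p))
          ≈⟨ lhs-unfold N β (suc p) ⟩
        sumTo (suc N) (λ M → weight (N ∸ M) * β (N ∸ M) * invQfac M * chainWeight N β (suc p) M)
          ≈⟨ sumTo-cong-≤ N expand ⟩
        sumTo (suc N) (λ M → sumTo (suc M) (λ m → A m * B M m))
          ≈⟨ sumTo-triangle (suc N) _ ⟩
        sumTo (suc N) (λ m → sumTo (suc N ∸ m) (λ s → A m * B (m ℕ.+ s) m))
          ≈⟨ sumTo-cong-≤ N column ⟩
        sumTo (suc N) (λ m → A m * baileyβ β (N ∸ m))
          ≈⟨ sumTo-cong (suc N) (λ m → trans (solve 4 (λ w i c b → w :* i :* c :* b := w :* b :* i :* c) refl _ _ _ _)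
                                               (*-congˡ (reflexive (chainWeight-irrelevant N β (baileyβ β) p m)))) ⟩
        sumTo (suc N) (λ m → weight (N ∸ m) * baileyβ β (N ∸ m) * invQfac m * chainWeight N (baileyβ β) p m)
          ≈⟨ lhs-unfold N (baileyβ β) p ⟨
        lhs (suc N) (baileyβ β) (suc p) ∎
        where
        A : ℕ → Carrier
        A m = weight (N ∸ m) * invQfac m * chainWeight N β p m
        B : ℕ → ℕ → Carrier
        B M m = weight (N ∸ M) * β (N ∸ M) * invQfac (M ∸ m)
        expand : ∀ M → M ≤ N →
          weight (N ∸ M) * β (N ∸ M) * invQfac M * chainWeight N β (suc p) M ≈ sumTo (suc M) (λ m → A m * B M m)
        expand M M≤N = begin
          weight (N ∸ M) * β (N ∸ M) * invQfac M * chainWeight N β (suc p) M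
            ≈⟨ *-congˡ (chainWeight-suc N β p M) ⟩
          weight (N ∸ M) * β (N ∸ M) * invQfac M * sumTo (suc M) (λ m → wexp (suc N) β m * qbinom M m * chainWeight N β p m)
            ≈⟨ *-distribˡ-sumTo (suc M) _ _ ⟩
          sumTo (suc M) (λ m → weight (N ∸ M) * β (N ∸ M) * invQfac M * (wexp (suc N) β m * qbinom M m * chainWeight N β p m))
            ≈⟨ sumTo-cong-≤ M term ⟩
          sumTo (suc M) (λ m → A m * B M m) ∎
          where
          term : ∀ m → m ≤ M →
            weight (N ∸ M) * β (N ∸ M) * invQfac M * (wexp (suc N) β m * qbinom M m * chainWeight N β p m) ≈ A m * B M m
          term m m≤M = begin
            weight (N ∸ M) * β (N ∸ M) * invQfac M * (wexp (suc N) β m * qbinom M m * chainWeight N β p m)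
              ≈⟨ *-congˡ (*-congʳ (*-congʳ (wexp≈weight N β m (ℕ.≤-trans m≤M M≤N)))) ⟩
            weight (N ∸ M) * β (N ∸ M) * invQfac M
              * (weight (N ∸ m) * (qfac M * (invQfac (M ∸ m) * invQfac m)) * chainWeight N β p m)
              ≈⟨ solve 8 (λ w b i v f j k c → w :* b :* i :* (v :* (f :* (j :* k)) :* c)
                                              := f :* i :* (v :* k :* c :* (w :* b :* j)))
                   refl _ _ _ _ _ _ _ _ ⟩
            qfac M * invQfac M * (A m * B M m)
              ≈⟨ trans (*-congʳ (qfac-invQfac M)) (*-identityˡ _) ⟩
            A m * B M m ∎
        column : ∀ m → m ≤ N → sumTo (suc N ∸ m) (λ s → A m * B (m ℕ.+ s) m) ≈ A m * baileyβ β (N ∸ m)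
        column m m≤N = begin
          sumTo (suc N ∸ m) (λ s → A m * B (m ℕ.+ s) m)
            ≡⟨ P.cong (λ e → sumTo e (λ s → A m * B (m ℕ.+ s) m)) (ℕ.+-∸-assoc 1 m≤N) ⟩
          sumTo (suc (N ∸ m)) (λ s → A m * B (m ℕ.+ s) m)
            ≈⟨ *-distribˡ-sumTo (suc (N ∸ m)) (A m) _ ⟨
          A m * sumTo (suc (N ∸ m)) (λ s → B (m ℕ.+ s) m)
            ≈⟨ *-congˡ (sumTo-cong (suc (N ∸ m)) (λ s → reflexive
                 (P.cong₂ (λ e f → weight e * β e * invQfac f) (P.sym (ℕ.∸-+-assoc N m s)) (ℕ.m+n∸m≡n m s)))) ⟩
          A m * sumTo (suc (N ∸ m)) (λ s → weight (N ∸ m ∸ s) * β (N ∸ m ∸ s) * invQfac s)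
            ≈⟨ *-congˡ (baileyβ-reversed β (N ∸ m)) ⟨
          A m * baileyβ β (N ∸ m) ∎

      lhs≈iterate-baileyβ : ∀ β p → lhs (suc N) β (suc p) ≈ iterate baileyβ β (suc p) N
      lhs≈iterate-baileyβ β zero = lhs-one N β
      lhs≈iterate-baileyβ β (suc p) = trans (lhs-step β p) (lhs≈iterate-baileyβ (baileyβ β) p)

    invQfac-∸ : ∀ n k → k ≤ n → invQfac (n ∸ k) ≈ invQfac n * topQfac n k
    invQfac-∸ n zero _ = sym (*-identityʳ _)
    invQfac-∸ n (suc k) k<n = begin
      invQfac a
        ≈⟨ trans (*-assoc _ _ _) (trans (*-congˡ (trans (*-comm _ _) (u-inverse a))) (*-identityʳ _)) ⟨
      invQfac (suc a) * (1# − pow q (suc a))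
        ≡⟨ P.cong (λ d → invQfac d * (1# − pow q d)) (ℕ.+-∸-assoc 1 k<n) ⟨
      invQfac (n ∸ k) * (1# − pow q (n ∸ k))
        ≈⟨ *-congʳ (invQfac-∸ n k (ℕ.<⇒≤ k<n)) ⟩
      invQfac n * topQfac n k * (1# − pow q (n ∸ k))
        ≈⟨ *-assoc _ _ _ ⟩
      invQfac n * topQfac n (suc k) ∎
      where a = n ∸ suc k

    rhs-term : q * qi ≈ 1# → ∀ (α : ℕ → Carrier) p n k → k ≤ n →
      pow (weight k) p * α k * baileyKernel n k
        ≈ invQfac n * invPoch 1 n
          * (poch (+ 1 ℤ.- + suc n) k * invPoch (suc n) k * pow (- 1#) k
             * qz (+ (suc n ℕ.* k) ℤ.- + (suc k C 2) ℤ.+ + (p ℕ.* (k ℕ.* k ℕ.+ k))) * α k)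
    rhs-term q·qi≈1 α p n k k≤n = begin
      pow (weight k) p * α k * (invQfac (n ∸ k) * invPoch 1 (n ℕ.+ k))
        ≈⟨ *-congˡ (*-cong (invQfac-∸ n k k≤n) (prodTo-split n k _)) ⟩
      pow (weight k) p * α k * (invQfac n * topQfac n k * (invPoch 1 n * invPoch (suc n) k))
        ≈⟨ *-congˡ (*-congʳ (*-congˡ (poch-reflection q·qi≈1 n k k≤n))) ⟨
      pow (weight k) p * α k * (invQfac n * (poch b k * pow (- 1#) k * pow q (topSum n k)) * (invPoch 1 n * invPoch (suc n) k))
        ≈⟨ solve 8 (λ W a i P s Q j J → W :* a :* (i :* (P :* s :* Q) :* (j :* J))
                                       := i :* j :* (P :* J :* s :* (Q :* W) :* a))
             refl _ _ _ _ _ _ _ _ ⟩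
      invQfac n * invPoch 1 n * (poch b k * invPoch (suc n) k * pow (- 1#) k * (pow q (topSum n k) * pow (weight k) p) * α k)
        ≈⟨ *-congˡ (*-congʳ (*-congˡ exponent)) ⟨
      invQfac n * invPoch 1 n * (poch b k * invPoch (suc n) k * pow (- 1#) k * qz (e ℤ.+ + (p ℕ.* (k ℕ.* k ℕ.+ k))) * α k) ∎
      where
      b = + 1 ℤ.- + suc n
      e = + (suc n ℕ.* k) ℤ.- + (suc k C 2)
      weight-power : ∀ k p → k ℕ.* suc k ℕ.* p ≡ p ℕ.* (k ℕ.* k ℕ.+ k)
      weight-power = solve-∀
      exponent : qz (e ℤ.+ + (p ℕ.* (k ℕ.* k ℕ.+ k))) ≈ pow q (topSum n k) * pow (weight k) p
      exponent = begin
        qz (e ℤ.+ + (p ℕ.* (k ℕ.* k ℕ.+ k)))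
          ≡⟨ P.cong (λ z → qz (z ℤ.+ + (p ℕ.* (k ℕ.* k ℕ.+ k)))) (topSum-ℤ n k k≤n) ⟩
        pow q (topSum n k ℕ.+ p ℕ.* (k ℕ.* k ℕ.+ k))
          ≈⟨ pow-+ q (topSum n k) _ ⟩
        pow q (topSum n k) * pow q (p ℕ.* (k ℕ.* k ℕ.+ k))
          ≈⟨ *-congˡ (trans (pow-* q (k ℕ.* suc k) p) (pow-cong q (weight-power k p))) ⟨
        pow q (topSum n k) * pow (weight k) p ∎

proposition2p3 : {c ℓ : Level} (R : CommutativeRing c ℓ) →
    let open CommutativeRing R in
    (q qi : Carrier) → q * qi ≈ 1# →
    (u : ℕ → Carrier) → (∀ j → (1# + (- QSeries.pow R q qi u q (suc j))) * u j ≈ 1#) →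
    (α β : ℕ → Carrier) → QSeries.IsBaileyPairRelq R q qi u α β →
    (p n : ℕ) → 1 ≤ p → 1 ≤ n →
    QSeries.lhs R q qi u n β p ≈ QSeries.rhs R q qi u α p n
proposition2p3 R q qi q·qi≈1 u u-inverse α β αβ (suc p) (suc N) _ _ = begin
  lhs (suc N) β (suc p)
    ≈⟨ lhs≈iterate-baileyβ u-inverse N β p ⟩
  iterate baileyβ β (suc p) N
    ≈⟨ baileyChain u-inverse αβ (suc p) N ⟩
  sumTo (suc N) (λ k → pow (weight k) (suc p) * α k * baileyKernel N k)
    ≈⟨ trans (sumTo-cong-≤ N (rhs-term u-inverse q·qi≈1 α (suc p) N)) (sym (*-distribˡ-sumTo (suc N) _ _)) ⟩
  rhs α (suc p) (suc N) ∎
  where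
  open CommutativeRing R
  open QSeries R q qi u
  open BaileyChain R q qi u
  open import Relation.Binary.Reasoning.Setoid setoid
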